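{- Let $A$ be a set and $FX=2\times(X+\{\bot\})^A$ on $\mathsf{Set}$. For every pointed $F$-coalgebra $(C,\langle o,\delta\rangle,q_0)$ (partial deterministic automaton), its tree unravelling is given by its coalgebra of defined inputs: the map $P\to C$ sending $w$ to the unique $q$ with $\delta^*(q_0)(w)=\mathsf{inl}(q)$ is a pointed coalgebra morphism $(P,\langle\bar o,\bar\delta\rangle,\varepsilon)\to(C,\langle o,\delta\rangle,q_0)$ whose domain is a tree, and the domain of every tree unravelling of $(C,\langle o,\delta\rangle,q_0)$ is isomorphic as a pointed coalgebra to $(P,\langle\bar o,\bar\delta\rangle,\varepsilon)$.
   Context: Pointed coalgebras in $\mathsf{Set}$ use $I=1$. Extend $\delta$ to $\delta^*\colon C\to(C+\{\bot\})^{A^*}$ by $\delta^*(q)(\varepsilon)=\mathsf{inl}(q)$, $\delta^*(q)(wa)=\delta(q')(a)$ if $\delta^*(q)(w)=\mathsf{inl}(q')$, and $\mathsf{inr}(\bot)$ otherwise. Coalgebra of defined inputs: $P=\{w\in A^*\mid\exists q\in C:\delta^*(q_0)(w)=\mathsf{inl}(q)\}$, $\bar o(w)=o(q)$ for $\delta^*(q_0)(w)=\mathsf{inl}(q)$, $\bar\delta(w)(a)=\mathsf{inl}(wa)$ if $wa\in P$, else $\mathsf{inr}(\bot)$, point $\varepsilon$ (empty word). A pointed coalgebra morphism $h\colon(T,t,x)\to(C,c,y)$ is a map with $c\cdot h=Fh\cdot t$ and $h(x)=y$; it is a split epimorphism of pointed coalgebras if some pointed coalgebra morphism $s$ has $h\cdot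 s=\mathrm{id}$. A pointed coalgebra is a tree if every pointed coalgebra morphism into it is a split epimorphism of pointed coalgebras. A tree unravelling of a pointed coalgebra is a pointed coalgebra morphism into it whose domain is a tree. -}

module Defs where

open import Data.Bool using (Bool)
open import Data.Unit using (⊤; tt)
open import Data.Empty using (⊥)
open import Data.Sum using (_⊎_; inj₁; inj₂)
import Data.Sum as Sum
open import Data.Product using (Σ; _×_; _,_; proj₁; proj₂)
open import Relation.Nullary using (Dec; yes; no)
open import Relation.Binary.PropositionalEquality using (_≡_)

-- The functor F X = 2 × (X + {⊥})^A ; the singleton {⊥} is rendered as ⊤.
F : Set → Set → Set
F A X = Bool × (A → X ⊎ ⊤)

Fmap : {A X Y : Set} → (X → Y) → F A X → F A Y
Fmap h (b , f) = b , (λ a → Sum.map₁ h (f a))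

record PCoalg (A : Set) : Set₁ where
  field
    Carrier : Set
    str     : Carrier → F A Carrier
    point   : Carrier

  o : Carrier → Bool
  o q = proj₁ (str q)

  δ : Carrier → A → Carrier ⊎ ⊤
  δ q = proj₂ (str q)

open PCoalg

-- h is a pointed coalgebra morphism: c ∘ h = Fh ∘ t (stated componentwise
-- and pointwise, since Agda has no function extensionality) and h x = y.
record IsHom {A : Set} (S T : PCoalg A) (h : Carrier S → Carrier T) : Set where
  field
    hom-out   : ∀ x → proj₁ (str T (h x)) ≡ proj₁ (Fmap h (str S x))
    hom-next  : ∀ x a → proj₂ (str T (h x)) a ≡ proj₂ (Fmap h (str S x)) a
    hom-point : h (point S) ≡ point T

Hom : {A : Set} → PCoalg A → PCoalg A → Set
Hom S T = Σ (Carrier S → Carrier T) (IsHom S T)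

SplitEpi : {A : Set} {S T : PCoalg A} → Hom S T → Set
SplitEpi {S = S} {T} h = Σ (Hom T S) λ s → ∀ y → proj₁ h (proj₁ s y) ≡ y

IsTree : {A : Set} → PCoalg A → Set₁
IsTree {A} T = (S : PCoalg A) (h : Hom S T) → SplitEpi h

TreeUnravelling : {A : Set} → PCoalg A → Set₁
TreeUnravelling {A} M = Σ (PCoalg A) λ T → IsTree T × Hom T M

Iso : {A : Set} → PCoalg A → PCoalg A → Set
Iso S T = Σ (Hom S T) λ f → Σ (Hom T S) λ g →
            (∀ x → proj₁ g (proj₁ f x) ≡ x) × (∀ y → proj₁ f (proj₁ g y) ≡ y)

data Word (A : Set) : Set where
  ε   : Word A
  _▸_ : Word A → A → Word A

module DefinedInputs {A : Set} (M : PCoalg A) where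
  private
    C  = Carrier M
    q₀ = point M

  δ* : C → Word A → C ⊎ ⊤
  δ* q ε = inj₁ q
  δ* q (w ▸ a) with δ* q w
  ... | inj₁ q' = δ M q' a
  ... | inj₂ _  = inj₂ tt

  IsInl : C ⊎ ⊤ → Set
  IsInl (inj₁ _) = ⊤
  IsInl (inj₂ _) = ⊥

  isInl? : (x : C ⊎ ⊤) → Dec (IsInl x)
  isInl? (inj₁ _) = yes tt
  isInl? (inj₂ _) = no (λ ())

  getInl : (x : C ⊎ ⊤) → IsInl x → C
  getInl (inj₁ q) _ = q

  P : Set
  P = Σ (Word A) λ w → IsInl (δ* q₀ w)

  state : P → C
  state (w , d) = getInl (δ* q₀ w) d

  extend : (v : Word A) → Dec (IsInl (δ* q₀ v)) → P ⊎ ⊤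
  extend v (yes d) = inj₁ (v , d)
  extend v (no _)  = inj₂ tt

  ō : P → Bool
  ō p = o M (state p)

  δ̄ : P → A → P ⊎ ⊤
  δ̄ (w , _) a = extend (w ▸ a) (isInl? (δ* q₀ (w ▸ a)))

  DefinedInputs : PCoalg A
  DefinedInputs = record
    { Carrier = P
    ; str     = λ p → ō p , δ̄ p
    ; point   = ε , tt
    }

open DefinedInputs public using (DefinedInputs; state)

{-# OPTIONS --safe #-}
-- Every defined input w is reached from ε by reading w, so a morphism out of P
-- must send w to the state its target reaches by reading w; hence morphisms out
-- of P are unique. Morphisms commute with δ*, so a coalgebra S over M can read
-- every w ∈ P, which gives a morphism P → S. Splitting h : S → P, and identifying
-- a tree unravelling with P, then reduce to uniqueness of endomorphisms of P.
module Submission where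

open import Defs
open import Data.Empty using (⊥-elim)
open import Data.Product using (_×_; _,_; proj₁; proj₂)
open import Data.Sum using (_⊎_; inj₁; inj₂; map₁)
open import Data.Sum.Properties using (inj₁-injective; map-id; map-map)
open import Data.Unit using (⊤; tt)
open import Function using (id; _∘_)
open import Relation.Nullary using (¬_; yes; no)
open import Relation.Binary.PropositionalEquality
open Defs.DefinedInputs using (δ*; IsInl; isInl?; getInl; P; extend)

open PCoalg
open IsHom

module _ {A : Set} where

  idʰ : (S : PCoalg A) → Hom S S
  idʰ S = id , record
    { hom-out   = λ _ → refl
    ; hom-next  = λ x a → sym (map-id (δ S x a))
    ; hom-point = refl
    }

  _∘ʰ_ : {R S T : PCoalg A} → Hom S T → Hom R S → Hom R T
  _∘ʰ_ {R} (f , f-hom) (g , g-hom) = f ∘ g , record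
    { hom-out   = λ x → trans (hom-out f-hom (g x)) (hom-out g-hom x)
    ; hom-next  = λ x a → trans (hom-next f-hom (g x) a)
                    (trans (cong (map₁ f) (hom-next g-hom x a)) (map-map (δ R x a)))
    ; hom-point = trans (cong f (hom-point g-hom)) (hom-point f-hom)
    }

module _ {A : Set} (N : PCoalg A) where

  inj₁-getInl : ∀ x (d : IsInl N x) → x ≡ inj₁ (getInl N x d)
  inj₁-getInl (inj₁ _) _ = refl

  ¬IsInl⇒≡inj₂ : ∀ x → ¬ IsInl N x → x ≡ inj₂ tt
  ¬IsInl⇒≡inj₂ (inj₁ _) ¬d = ⊥-elim (¬d tt)
  ¬IsInl⇒≡inj₂ (inj₂ _) _  = refl

  IsInl-irrelevant : ∀ x (d d′ : IsInl N x) → d ≡ d′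
  IsInl-irrelevant (inj₁ _) _ _ = refl

  δ*-▸-inj₁ : ∀ {q q′} w a → δ* N q w ≡ inj₁ q′ → δ* N q (w ▸ a) ≡ δ N q′ a
  δ*-▸-inj₁ w a eq rewrite eq = refl

  δ*-▸-inj₂ : ∀ {q} w a → δ* N q w ≡ inj₂ tt → δ* N q (w ▸ a) ≡ inj₂ tt
  δ*-▸-inj₂ w a eq rewrite eq = refl

  IsInl-δ*-prefix : ∀ q w a → IsInl N (δ* N q (w ▸ a)) → IsInl N (δ* N q w)
  IsInl-δ*-prefix q w a d with δ* N q w
  ... | inj₁ _ = tt
  ... | inj₂ _ = d

module _ {A : Set} {S T : PCoalg A} (h : Carrier S → Carrier T) where

  IsInl-map₁⁺ : ∀ x → IsInl S x → IsInl T (map₁ h x)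
  IsInl-map₁⁺ (inj₁ _) _ = tt

  IsInl-map₁⁻ : ∀ x → IsInl T (map₁ h x) → IsInl S x
  IsInl-map₁⁻ (inj₁ _) _ = tt

PreservesRuns : ∀ {A} (S T : PCoalg A) → (Carrier S → Carrier T) → Set
PreservesRuns S T h = ∀ w → map₁ h (δ* S (point S) w) ≡ δ* T (point T) w

module _ {A : Set} {S T : PCoalg A} {h : Carrier S → Carrier T} (h-hom : IsHom S T h) where

  δ*-hom : ∀ q w → map₁ h (δ* S q w) ≡ δ* T (h q) w
  δ*-hom q ε       = refl
  δ*-hom q (w ▸ a) with δ* S q w | δ*-hom q w
  ... | inj₁ q′ | ih = sym (trans (δ*-▸-inj₁ T w a (sym ih)) (hom-next h-hom q′ a))
  ... | inj₂ _  | ih = sym (δ*-▸-inj₂ T w a (sym ih))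

  Hom⇒PreservesRuns : PreservesRuns S T h
  Hom⇒PreservesRuns w = trans (δ*-hom (point S) w) (cong (λ q → δ* T q w) (hom-point h-hom))

PreservesRuns-∘ : ∀ {A} {R S T : PCoalg A} {f : Carrier S → Carrier T} {g : Carrier R → Carrier S} →
                  PreservesRuns S T f → PreservesRuns R S g → PreservesRuns R T (f ∘ g)
PreservesRuns-∘ {R = R} {f = f} f-runs g-runs w =
  trans (sym (map-map (δ* R (point R) w))) (trans (cong (map₁ f) (g-runs w)) (f-runs w))

module _ {A : Set} (M : PCoalg A) where
  private
    𝒫  = DefinedInputs M
    q₀ = point M

  reached : Word A → P M ⊎ ⊤
  reached v = extend M v (isInl? M (δ* M q₀ v))

  reached-defined : ∀ w d → reached w ≡ inj₁ (w , d)
  reached-defined w d with isInl? M (δ* M q₀ w)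
  ... | yes d′ = cong (λ e → inj₁ (w , e)) (IsInl-irrelevant M _ d′ d)
  ... | no ¬d  = ⊥-elim (¬d d)

  δ*-DefinedInputs : ∀ v → δ* 𝒫 (point 𝒫) v ≡ reached v
  δ*-DefinedInputs ε       = refl
  δ*-DefinedInputs (w ▸ a) with isInl? M (δ* M q₀ w) | δ*-DefinedInputs w
  ... | yes d | ih = δ*-▸-inj₁ 𝒫 w a ih
  ... | no ¬d | ih with isInl? M (δ* M q₀ (w ▸ a))
  ...   | yes d′ = ⊥-elim (¬d (IsInl-δ*-prefix M q₀ w a d′))
  ...   | no _   = δ*-▸-inj₂ 𝒫 w a ih

  DefinedInputs-reachable : ∀ w d → δ* 𝒫 (point 𝒫) w ≡ inj₁ (w , d)
  DefinedInputs-reachable w d = trans (δ*-DefinedInputs w) (reached-defined w d)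

  module _ {X : PCoalg A} {k : P M → Carrier X} (k-runs : PreservesRuns 𝒫 X k) where

    PreservesRuns⇒δ*≡ : ∀ w d → δ* X (point X) w ≡ inj₁ (k (w , d))
    PreservesRuns⇒δ*≡ w d = trans (sym (k-runs w)) (cong (map₁ k) (DefinedInputs-reachable w d))

    PreservesRuns⇒IsHom : (∀ p → o X (k p) ≡ o M (state M p)) → IsHom 𝒫 X k
    PreservesRuns⇒IsHom k-out = record
      { hom-out   = k-out
      ; hom-next  = λ { (w , d) a → begin
          δ X (k (w , d)) a                 ≡⟨ sym (δ*-▸-inj₁ X w a (PreservesRuns⇒δ*≡ w d)) ⟩
          δ* X (point X) (w ▸ a)            ≡⟨ sym (k-runs (w ▸ a)) ⟩
          map₁ k (δ* 𝒫 (point 𝒫) (w ▸ a))  ≡⟨ cong (map₁ k) (δ*-DefinedInputs (w ▸ a)) ⟩ -- δ 𝒫 (w , d) a unfolds to reached (w ▸ a)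
          map₁ k (δ 𝒫 (w , d) a)           ∎ }
      ; hom-point = inj₁-injective (k-runs ε)
      }
      where open ≡-Reasoning

  PreservesRuns-unique : ∀ {X} {f g : P M → Carrier X} →
                         PreservesRuns 𝒫 X f → PreservesRuns 𝒫 X g → ∀ p → f p ≡ g p
  PreservesRuns-unique f-runs g-runs (w , d) =
    inj₁-injective (trans (sym (PreservesRuns⇒δ*≡ f-runs w d)) (PreservesRuns⇒δ*≡ g-runs w d))

  DefinedInputs-hom-unique : ∀ {X} (f g : Hom 𝒫 X) → ∀ p → proj₁ f p ≡ proj₁ g p
  DefinedInputs-hom-unique (_ , f-hom) (_ , g-hom) =
    PreservesRuns-unique (Hom⇒PreservesRuns f-hom) (Hom⇒PreservesRuns g-hom)

  state-reached : ∀ v → map₁ (state M) (reached v) ≡ δ* M q₀ v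
  state-reached v with isInl? M (δ* M q₀ v)
  ... | yes d = sym (inj₁-getInl M _ d)
  ... | no ¬d = sym (¬IsInl⇒≡inj₂ M _ ¬d)

  state-PreservesRuns : PreservesRuns 𝒫 M (state M)
  state-PreservesRuns v = trans (cong (map₁ (state M)) (δ*-DefinedInputs v)) (state-reached v)

  state-isHom : IsHom 𝒫 M (state M)
  state-isHom = PreservesRuns⇒IsHom state-PreservesRuns (λ _ → refl)

  module _ {S : PCoalg A} {g : Carrier S → Carrier M} (g-hom : IsHom S M g) where
    private
      s₀     = point S
      g-runs = Hom⇒PreservesRuns g-hom

    lift : P M → Carrier S
    lift (w , d) = getInl S (δ* S s₀ w) (IsInl-map₁⁻ g _ (subst (IsInl M) (sym (g-runs w)) d))

    lift-reached : ∀ v → map₁ lift (reached v) ≡ δ* S s₀ v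
    lift-reached v with isInl? M (δ* M q₀ v)
    ... | yes d = sym (inj₁-getInl S _ _)
    ... | no ¬d = sym (¬IsInl⇒≡inj₂ S _ (¬d ∘ subst (IsInl M) (g-runs v) ∘ IsInl-map₁⁺ g _))

    lift-PreservesRuns : PreservesRuns 𝒫 S lift
    lift-PreservesRuns v = trans (cong (map₁ lift) (δ*-DefinedInputs v)) (lift-reached v)

    lift-out : ∀ p → o S (lift p) ≡ o M (state M p)
    lift-out p = trans (sym (hom-out g-hom (lift p))) (cong (o M) g∘lift≗state)
      where
      g∘lift≗state : g (lift p) ≡ state M p
      g∘lift≗state = PreservesRuns-unique (PreservesRuns-∘ g-runs lift-PreservesRuns) state-PreservesRuns p

  DefinedInputs-hom : {S : PCoalg A} → Hom S M → Hom 𝒫 S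
  DefinedInputs-hom (_ , g-hom) = lift g-hom , PreservesRuns⇒IsHom (lift-PreservesRuns g-hom) (lift-out g-hom)

  DefinedInputs-isTree : IsTree 𝒫
  DefinedInputs-isTree S h = k , DefinedInputs-hom-unique (h ∘ʰ k) (idʰ 𝒫)
    where k = DefinedInputs-hom ((state M , state-isHom) ∘ʰ h)

  TreeUnravelling⇒Iso-DefinedInputs : (U : TreeUnravelling M) → Iso (proj₁ U) 𝒫
  TreeUnravelling⇒Iso-DefinedInputs (T , T-isTree , g) =
    s , k , k∘s≗id , DefinedInputs-hom-unique (s ∘ʰ k) (idʰ 𝒫)
    where
    k = DefinedInputs-hom g
    s = proj₁ (T-isTree 𝒫 k)
    k∘s≗id = proj₂ (T-isTree 𝒫 k)

corollary5p10 : (A : Set) (M : PCoalg A) →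
    IsHom (DefinedInputs M) M (state M)
    × IsTree (DefinedInputs M)
    × ((U : TreeUnravelling M) → Iso (proj₁ U) (DefinedInputs M))
corollary5p10 A M = state-isHom M , DefinedInputs-isTree M , TreeUnravelling⇒Iso-DefinedInputs M
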